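{- Let $i,k$ be nonnegative integers. For every integer $N\ge 1$, \[ F_N(i,0,k;x) - F_{N-1}(i,0,k;xq) - xq^{i+1} F_{N-2}(i,0,k;xq^2) + x^{2k+1}q^{\binom{2k+2}{2}+i} F_{N-(2k+1)}(i,0,k;xq^{2k+1})=0. \]
   Context: Gaussian binomial: ${A\brack B}_q=0$ if $B>A$ or $B<0$, otherwise $\frac{(q;q)_A}{(q;q)_B(q;q)_{A-B}}$, with $(a;q)_n=\prod_{t=0}^{n-1}(1-aq^t)$. For nonnegative integers $i,k$ and integer $N$: $F_N(i,0,k;x)=0$ if $N<0$, and for $N\ge 0$ \[ F_N(i,0,k;x)=\sum_{m,n\geq 0} (-1)^n q^{\binom{(2k+1)n+1}{2} + m^2 + (2k+1)mn + i(m+n)} x^{m+(2k+1)n} {N-(2k+1)n-m\brack m}_q {N-2kn -m \brack n}_{q^{2k+1}}. \] $F_N(i,0,k;xq^r)$ denotes this polynomial with $x$ replaced by $xq^r$. -}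

module Defs where

open import Data.Nat using (ℕ; zero; suc; _∸_; _≤ᵇ_; _≡ᵇ_) renaming (_+_ to _+ℕ_; _*_ to _*ℕ_)
open import Data.Nat.Combinatorics using (_C_)
open import Data.Bool using (if_then_else_)
open import Data.Integer using (ℤ; +_; -[1+_]; 0ℤ; 1ℤ; _+_; _-_; _*_; -_)

-- Formal power series in q with integer coefficients: f j = coefficient of q^j.
QS : Set
QS = ℕ → ℤ

-- Formal power series in x and q: S a b = coefficient of x^a q^b.
Series : Set
Series = ℕ → ℕ → ℤ

sumTo : ℕ → (ℕ → ℤ) → ℤ
sumTo zero    f = 0ℤ
sumTo (suc n) f = sumTo n f + f n

qzero : QS
qzero _ = 0ℤ

qmono : ℕ → QS
qmono e j = if j ≡ᵇ e then 1ℤ else 0ℤ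

qone : QS
qone = qmono 0

qsub : QS → QS → QS
qsub f g j = f j - g j

qmul : QS → QS → QS
qmul f g b = sumTo (suc b) (λ j → f j * g (b ∸ j))

poch : ℕ → ℕ → QS
poch s zero    = qone
poch s (suc n) = qmul (poch s n) (qsub qone (qmono (s *ℕ suc n)))

-- Multiplicative inverse in ℤ[[q]] of a series with constant term 1
-- (coefficients computed by the usual recursion; invApprox f n is correct
-- on indices ≤ n).
invApprox : QS → ℕ → QS
invApprox f zero    j = if j ≡ᵇ 0 then 1ℤ else 0ℤ
invApprox f (suc n) j =
  if j ≤ᵇ n then invApprox f n j
  else (if j ≡ᵇ suc n
        then - sumTo (suc n) (λ t → f (suc n ∸ t) * invApprox f n t)
        else 0ℤ)

qinv : QS → QS
qinv f b = invApprox f b b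

-- Gaussian binomial [A over B] in base q^s, for 0 ≤ B ≤ A:
-- (q^s;q^s)_A / ((q^s;q^s)_B (q^s;q^s)_{A-B})  (quotient taken in ℤ[[q]])
gaussNat : ℕ → ℕ → ℕ → QS
gaussNat s A B = qmul (poch s A) (qinv (qmul (poch s B) (poch s (A ∸ B))))

qbin : ℕ → ℤ → ℕ → QS
qbin s (+ a)     B = if B ≤ᵇ a then gaussNat s a B else qzero
qbin s -[1+ _ ]  B = qzero

sgn : ℕ → ℤ
sgn zero    = 1ℤ
sgn (suc n) = - sgn n

-- F_N(i,0,k;x) as a series in x,q.  The coefficient of x^a q^b is the sum
-- over all (m,n) with m + (2k+1) n = a (all such m,n ≤ a) of the q^b
-- coefficient of the corresponding term.
F : ℕ → ℕ → ℤ → Series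
F i k -[1+ _ ] a b = 0ℤ
F i k (+ N)    a b =
  sumTo (suc a) λ n → sumTo (suc a) λ m →
    if (m +ℕ (K *ℕ n)) ≡ᵇ a
    then sgn n * (if E n m ≤ᵇ b then G n m (b ∸ E n m) else 0ℤ)
    else 0ℤ
  where
  K : ℕ
  K = 2 *ℕ k +ℕ 1
  E : ℕ → ℕ → ℕ
  E n m = ((K *ℕ n +ℕ 1) C 2) +ℕ m *ℕ m +ℕ K *ℕ m *ℕ n +ℕ i *ℕ (m +ℕ n)
  G : ℕ → ℕ → QS
  G n m = qmul (qbin 1 (+ N - + (K *ℕ n) - + m) m)
               (qbin K (+ N - + (2 *ℕ k *ℕ n) - + m) n)

-- substitution x ↦ x q^r
subX : ℕ → Series → Series
subX r S a b = if r *ℕ a ≤ᵇ b then S a (b ∸ r *ℕ a) else 0ℤ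

-- multiplication by the monomial x^c q^d
monoMul : ℕ → ℕ → Series → Series
monoMul c d S a b = if c ≤ᵇ a then (if d ≤ᵇ b then S (a ∸ c) (b ∸ d) else 0ℤ) else 0ℤ

LHS : ℕ → ℕ → ℤ → Series
LHS i k N a b =
  F i k N a b
  - subX 1 (F i k (N - + 1)) a b
  - monoMul 1 (i +ℕ 1) (subX 2 (F i k (N - + 2))) a b
  + monoMul (2 *ℕ k +ℕ 1) (((2 *ℕ k +ℕ 2) C 2) +ℕ i)
      (subX (2 *ℕ k +ℕ 1) (F i k (N - + (2 *ℕ k +ℕ 1)))) a b

-- With K = 2k + 1, F_N(x) = Σ_{m,n} x^(m+Kn) (-1)^n q^E(n,m) [N-Kn-m, m]_q [N-2kn-m, n]_(q^K).
-- Each of the four terms of the recurrence is again a double series of this shape: x q^(i+1) and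
-- x^K q^((K+1)C2 + i) shift m or n by one, and in every case the power of q collects to q^E(n,m).
-- So it suffices that for all m, n, with A = N-Kn-m, a₁ = [A, m], a₀ = [A-1, m], p = [A-1, m-1] and likewise
-- b₁, b₀, r for B = N-2kn-m in base q^K,
--     a₁ b₁ - q^(m+Kn) a₀ b₀ - q^(Kn) p b₀ - a₁ r = 0,
-- which follows by expanding a₁ and b₁ with Pascal's rule [A, m] = [A-1, m-1] + q^m [A-1, m].
-- The rule fails only for [0, 0], and there N ≥ 1 forces a₁ = 0 or b₀ = 0. The Gaussian binomials
-- are handled through this recursion, identified with the quotient of q-Pochhammer symbols in the
-- definition by the product formula.
module Submission where

open import Defs
open import Algebra.Bundles using (CommutativeRing)
open import Algebra.Structures using (IsCommutativeRing)
import Algebra.Solver.Ring.AlmostCommutativeRing as ACR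
open import Data.Bool using (Bool; true; false; if_then_else_)
open import Data.Integer
  using (ℤ; +_; -[1+_]; 0ℤ; 1ℤ; _+_; _-_; _*_; -_; +≤+) renaming (_≤_ to _≤ℤ_)
import Data.Integer as ℤ
import Data.Integer.Properties as ℤ
open import Data.Maybe using (Maybe; just; nothing)
open import Data.Nat
  using (ℕ; zero; suc; _∸_; _≤ᵇ_; _≡ᵇ_; _≤_; _<_; _≰_; z≤n; s≤s; _≤?_; _≟_)
  renaming (_+_ to _+ℕ_; _*_ to _*ℕ_)
import Data.Nat.Properties as ℕ
open import Data.Nat.Combinatorics using (_C_; nC1≡n; nCk+nC[k+1]≡[n+1]C[k+1])
import Data.Nat.Tactic.RingSolver as ℕ-Solver
import Data.Integer.Tactic.RingSolver as ℤ-Solver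
open import Data.Product using (Σ; _,_)
open import Data.Sum using (_⊎_; inj₁; inj₂)
open import Function using (_∘_)
open import Level using (0ℓ)
open import Relation.Binary.PropositionalEquality
  using (_≡_; _≢_; refl; sym; trans; cong; cong₂; subst; module ≡-Reasoning)
open import Relation.Binary.Structures using (IsEquivalence)
import Relation.Binary.Reasoning.Setoid
open import Relation.Nullary using (Dec; yes; no; contradiction)
open import Relation.Nullary.Decidable using (dec-true; dec-false)

open import Algebra.Properties.CommutativeSemigroup ℤ.+-commutativeSemigroup
  using (interchange)

≤ᵇ-true : ∀ {m n} → m ≤ n → (m ≤ᵇ n) ≡ true
≤ᵇ-true = dec-true (_ ≤? _)

≤ᵇ-false : ∀ {m n} → m ≰ n → (m ≤ᵇ n) ≡ false
≤ᵇ-false = dec-false (_ ≤? _)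

≡ᵇ-true : ∀ {m n} → m ≡ n → (m ≡ᵇ n) ≡ true
≡ᵇ-true = dec-true (_ ≟ _)

≡ᵇ-false : ∀ {m n} → m ≢ n → (m ≡ᵇ n) ≡ false
≡ᵇ-false = dec-false (_ ≟ _)

≤ᵇ-∸ : ∀ x {y a} → y ≤ a → (x ≤ᵇ a ∸ y) ≡ (y +ℕ x ≤ᵇ a)
≤ᵇ-∸ x {y} {a} y≤a with x ≤? a ∸ y
... | yes x≤a-y = trans (≤ᵇ-true x≤a-y) (sym (≤ᵇ-true (subst (_≤ a) (ℕ.+-comm x y) (ℕ.m≤o∸n⇒m+n≤o x y≤a x≤a-y))))
... | no  x≰a-y = trans (≤ᵇ-false x≰a-y) (sym (≤ᵇ-false (x≰a-y ∘ ℕ.m+n≤o⇒m≤o∸n x ∘ subst (_≤ a) (ℕ.+-comm y x))))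

-- Finite sums

sumTo-cong : ∀ n {f g : ℕ → ℤ} → (∀ j → j < n → f j ≡ g j) → sumTo n f ≡ sumTo n g
sumTo-cong zero    eq = refl
sumTo-cong (suc n) eq = cong₂ _+_ (sumTo-cong n (λ j j<n → eq j (ℕ.m<n⇒m<1+n j<n))) (eq n ℕ.≤-refl)

sumTo-zero : ∀ n {f : ℕ → ℤ} → (∀ j → j < n → f j ≡ 0ℤ) → sumTo n f ≡ 0ℤ
sumTo-zero zero    vanish = refl
sumTo-zero (suc n) vanish =
  cong₂ _+_ (sumTo-zero n (λ j j<n → vanish j (ℕ.m<n⇒m<1+n j<n))) (vanish n ℕ.≤-refl)

sumTo-+ : ∀ n (f g : ℕ → ℤ) → sumTo n (λ j → f j + g j) ≡ sumTo n f + sumTo n g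
sumTo-+ zero    f g = refl
sumTo-+ (suc n) f g =
  trans (cong (_+ (f n + g n)) (sumTo-+ n f g)) (interchange (sumTo n f) (sumTo n g) (f n) (g n))

sumTo-neg : ∀ n (f : ℕ → ℤ) → sumTo n (λ j → - f j) ≡ - sumTo n f
sumTo-neg zero    f = refl
sumTo-neg (suc n) f =
  trans (cong (_+ - f n) (sumTo-neg n f)) (sym (ℤ.neg-distrib-+ (sumTo n f) (f n)))

sumTo-*ˡ : ∀ n c (f : ℕ → ℤ) → c * sumTo n f ≡ sumTo n (λ j → c * f j)
sumTo-*ˡ zero    c f = ℤ.*-zeroʳ c
sumTo-*ˡ (suc n) c f =
  trans (ℤ.*-distribˡ-+ c (sumTo n f) (f n)) (cong (_+ c * f n) (sumTo-*ˡ n c f))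

sumTo-*ʳ : ∀ n c (f : ℕ → ℤ) → sumTo n f * c ≡ sumTo n (λ j → f j * c)
sumTo-*ʳ n c f =
  trans (ℤ.*-comm (sumTo n f) c)
        (trans (sumTo-*ˡ n c f) (sumTo-cong n (λ j _ → ℤ.*-comm c (f j))))

sumTo-head : ∀ n (f : ℕ → ℤ) → sumTo (suc n) f ≡ f 0 + sumTo n (f ∘ suc)
sumTo-head zero    f = trans (ℤ.+-identityˡ (f 0)) (sym (ℤ.+-identityʳ (f 0)))
sumTo-head (suc n) f =
  trans (cong (_+ f (suc n)) (sumTo-head n f)) (ℤ.+-assoc (f 0) (sumTo n (f ∘ suc)) (f (suc n)))

sumTo-reverse : ∀ n (f : ℕ → ℤ) → sumTo n f ≡ sumTo n (λ j → f (n ∸ suc j))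
sumTo-reverse zero    f = refl
sumTo-reverse (suc n) f =
  trans (cong (_+ f n) (sumTo-reverse n f))
        (trans (ℤ.+-comm _ (f n)) (sym (sumTo-head n (λ j → f (suc n ∸ suc j)))))

sumTo-extend : ∀ L M (f : ℕ → ℤ) → L ≤ M → (∀ j → L ≤ j → j < M → f j ≡ 0ℤ) →
               sumTo L f ≡ sumTo M f
sumTo-extend L zero    f z≤n   vanish = refl
sumTo-extend L (suc M) f L≤1+M vanish with L ≟ suc M
... | yes refl = refl
... | no  L≢   =
  trans (sumTo-extend L M f L≤M (λ j L≤j j<M → vanish j L≤j (ℕ.m<n⇒m<1+n j<M)))
        (trans (sym (ℤ.+-identityʳ _)) (cong (_+_ (sumTo M f)) (sym (vanish M L≤M ℕ.≤-refl))))
  where L≤M = ℕ.m<1+n⇒m≤n (ℕ.≤∧≢⇒< L≤1+M L≢)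

sumTo-indicator : ∀ L t (X : ℕ → ℤ) → t < L →
                  sumTo L (λ j → if j ≡ᵇ t then X j else 0ℤ) ≡ X t
sumTo-indicator (suc L) t X t<1+L with t ≟ L
... | yes refl =
  trans (cong₂ _+_ (sumTo-zero L (λ j j<t → cong (if_then X j else 0ℤ) (≡ᵇ-false (ℕ.<⇒≢ j<t))))
                   (cong (if_then X t else 0ℤ) (≡ᵇ-true {t} refl)))
        (ℤ.+-identityˡ (X t))
... | no  t≢L  =
  trans (cong₂ _+_ (sumTo-indicator L t X (ℕ.≤∧≢⇒< (ℕ.m<1+n⇒m≤n t<1+L) t≢L))
                   (cong (if_then X L else 0ℤ) (≡ᵇ-false (t≢L ∘ sym))))
        (ℤ.+-identityʳ (X t))

sumTo-triangle : ∀ n (X : ℕ → ℕ → ℤ) →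
  sumTo n (λ j → sumTo (suc j) (λ l → X l j)) ≡ sumTo n (λ l → sumTo (n ∸ l) (λ t → X l (l +ℕ t)))
sumTo-triangle zero    X = refl
sumTo-triangle (suc n) X = begin
    sumTo n (λ j → sumTo (suc j) (λ l → X l j)) + sumTo (suc n) (λ l → X l n)
  ≡⟨ cong (_+ sumTo (suc n) (λ l → X l n)) (sumTo-triangle n X) ⟩
    sumTo n row + sumTo (suc n) (λ l → X l n)
  ≡⟨ cong (_+ sumTo (suc n) (λ l → X l n)) (sym (trans (cong (_+_ (sumTo n row)) empty-row) (ℤ.+-identityʳ (sumTo n row)))) ⟩
    sumTo (suc n) row + sumTo (suc n) (λ l → X l n)
  ≡⟨ sym (sumTo-+ (suc n) row (λ l → X l n)) ⟩
    sumTo (suc n) (λ l → row l + X l n)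
  ≡⟨ sumTo-cong (suc n) (λ l l<1+n → sym (longer-row l (ℕ.m<1+n⇒m≤n l<1+n))) ⟩
    sumTo (suc n) (λ l → sumTo (suc n ∸ l) (λ t → X l (l +ℕ t)))
  ∎
  where
  open ≡-Reasoning
  row : ℕ → ℤ
  row l = sumTo (n ∸ l) (λ t → X l (l +ℕ t))
  empty-row : row n ≡ 0ℤ
  empty-row = cong (λ u → sumTo u (λ t → X n (n +ℕ t))) (ℕ.n∸n≡0 n)
  longer-row : ∀ l → l ≤ n → sumTo (suc n ∸ l) (λ t → X l (l +ℕ t)) ≡ row l + X l n
  longer-row l l≤n rewrite ℕ.+-∸-assoc 1 l≤n = cong (λ u → row l + X l u) (ℕ.m+[n∸m]≡n l≤n)

-- The ring ℤ[[q]]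

infix  4 _≐_
infixl 6 _⊕_ _⊖_
infixl 7 _⊛_
infix  8 ⊝_

record _≐_ (f g : QS) : Set where
  constructor pointwise
  field coeff : ∀ b → f b ≡ g b
open _≐_ public

_⊕_ : QS → QS → QS
(f ⊕ g) b = f b + g b

⊝_ : QS → QS
(⊝ f) b = - f b

_⊖_ : QS → QS → QS
_⊖_ = qsub

_⊛_ : QS → QS → QS
_⊛_ = qmul

shift : ℕ → QS → QS
shift e f b = if e ≤ᵇ b then f (b ∸ e) else 0ℤ

scale : ℤ → QS → QS
scale c f b = c * f b

≐-isEquivalence : IsEquivalence _≐_
≐-isEquivalence = record
  { refl  = pointwise (λ _ → refl)
  ; sym   = λ f≐g → pointwise (λ b → sym (coeff f≐g b))
  ; trans = λ f≐g g≐h → pointwise (λ b → trans (coeff f≐g b) (coeff g≐h b))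
  }

⊛-cong : ∀ {f f′ g g′} → f ≐ f′ → g ≐ g′ → f ⊛ g ≐ f′ ⊛ g′
⊛-cong f≐f′ g≐g′ = pointwise λ b →
  sumTo-cong (suc b) (λ j _ → cong₂ _*_ (coeff f≐f′ j) (coeff g≐g′ (b ∸ j)))

⊛-assoc : ∀ f g h → (f ⊛ g) ⊛ h ≐ f ⊛ (g ⊛ h)
⊛-assoc f g h = pointwise λ b → begin
    sumTo (suc b) (λ j → sumTo (suc j) (λ l → f l * g (j ∸ l)) * h (b ∸ j))
  ≡⟨ sumTo-cong (suc b) (λ j _ → sumTo-*ʳ (suc j) (h (b ∸ j)) (λ l → f l * g (j ∸ l))) ⟩
    sumTo (suc b) (λ j → sumTo (suc j) (λ l → f l * g (j ∸ l) * h (b ∸ j)))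
  ≡⟨ sumTo-triangle (suc b) (λ l j → f l * g (j ∸ l) * h (b ∸ j)) ⟩
    sumTo (suc b) (λ l → sumTo (suc b ∸ l) (λ t → f l * g (l +ℕ t ∸ l) * h (b ∸ (l +ℕ t))))
  ≡⟨ sumTo-cong (suc b) (λ l l<1+b → inner-sum b l (ℕ.m<1+n⇒m≤n l<1+b)) ⟩
    sumTo (suc b) (λ l → f l * sumTo (suc (b ∸ l)) (λ t → g t * h (b ∸ l ∸ t)))
  ∎
  where
  open ≡-Reasoning
  inner-sum : ∀ b l → l ≤ b →
    sumTo (suc b ∸ l) (λ t → f l * g (l +ℕ t ∸ l) * h (b ∸ (l +ℕ t)))
      ≡ f l * sumTo (suc (b ∸ l)) (λ t → g t * h (b ∸ l ∸ t))
  inner-sum b l l≤b rewrite ℕ.+-∸-assoc 1 l≤b = trans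
    (sumTo-cong (suc (b ∸ l)) (λ t _ → trans (ℤ.*-assoc (f l) _ _)
      (cong₂ (λ u v → f l * (g u * h v)) (ℕ.m+n∸m≡n l t) (sym (ℕ.∸-+-assoc b l t)))))
    (sym (sumTo-*ˡ (suc (b ∸ l)) (f l) _))

⊛-comm : ∀ f g → f ⊛ g ≐ g ⊛ f
⊛-comm f g = pointwise λ b → trans (sumTo-reverse (suc b) _) (sumTo-cong (suc b) (λ j j<1+b →
  trans (ℤ.*-comm (f (b ∸ j)) _) (cong (λ u → g u * f (b ∸ j)) (ℕ.m∸[m∸n]≡n (ℕ.m<1+n⇒m≤n j<1+b)))))

⊛-distribˡ-⊕ : ∀ f g h → f ⊛ (g ⊕ h) ≐ f ⊛ g ⊕ f ⊛ h
⊛-distribˡ-⊕ f g h = pointwise λ b →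
  trans (sumTo-cong (suc b) (λ j _ → ℤ.*-distribˡ-+ (f j) _ _)) (sumTo-+ (suc b) _ _)

qmono-⊛ : ∀ e f → qmono e ⊛ f ≐ shift e f
qmono-⊛ e f = pointwise coefficient
  where
  coefficient : ∀ b → (qmono e ⊛ f) b ≡ shift e f b
  coefficient b with e ≤? b
  ... | yes e≤b = begin
      sumTo (suc b) (λ j → qmono e j * f (b ∸ j))
    ≡⟨ sumTo-cong (suc b) (λ j _ → if-float j) ⟩
      sumTo (suc b) (λ j → if j ≡ᵇ e then f (b ∸ j) else 0ℤ)
    ≡⟨ sumTo-indicator (suc b) e (λ j → f (b ∸ j)) (s≤s e≤b) ⟩
      f (b ∸ e)
    ≡⟨ cong (if_then f (b ∸ e) else 0ℤ) (≤ᵇ-true e≤b) ⟨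
      shift e f b
    ∎
    where
    open ≡-Reasoning
    if-float : ∀ j → qmono e j * f (b ∸ j) ≡ (if j ≡ᵇ e then f (b ∸ j) else 0ℤ)
    if-float j with j ≡ᵇ e
    ... | true  = ℤ.*-identityˡ _
    ... | false = refl
  ... | no  e≰b = trans (sumTo-zero (suc b) vanish)
                        (cong (if_then f (b ∸ e) else 0ℤ) (sym (≤ᵇ-false e≰b)))
    where
    vanish : ∀ j → j < suc b → qmono e j * f (b ∸ j) ≡ 0ℤ
    vanish j j<1+b rewrite ≡ᵇ-false {j} {e} (λ { refl → e≰b (ℕ.m<1+n⇒m≤n j<1+b) }) = refl

⊛-identityˡ : ∀ f → qone ⊛ f ≐ f
⊛-identityˡ = qmono-⊛ 0

ℤ[[q]]-isCommutativeRing : IsCommutativeRing _≐_ _⊕_ _⊛_ ⊝_ qzero qone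
ℤ[[q]]-isCommutativeRing = record
  { isRing = record
    { +-isAbelianGroup = record
      { isGroup = record
        { isMonoid = record
          { isSemigroup = record
            { isMagma = record
              { isEquivalence = ≐-isEquivalence
              ; ∙-cong = λ f≐f′ g≐g′ → pointwise λ b → cong₂ _+_ (coeff f≐f′ b) (coeff g≐g′ b)
              }
            ; assoc = λ f g h → pointwise λ b → ℤ.+-assoc (f b) (g b) (h b)
            }
          ; identity = (λ f → pointwise λ b → ℤ.+-identityˡ (f b))
                     , (λ f → pointwise λ b → ℤ.+-identityʳ (f b))
          }
        ; inverse = (λ f → pointwise λ b → ℤ.+-inverseˡ (f b))
                  , (λ f → pointwise λ b → ℤ.+-inverseʳ (f b))
        ; ⁻¹-cong = λ f≐g → pointwise λ b → cong -_ (coeff f≐g b)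
        }
      ; comm = λ f g → pointwise λ b → ℤ.+-comm (f b) (g b)
      }
    ; *-cong = ⊛-cong
    ; *-assoc = ⊛-assoc
    ; *-identity = ⊛-identityˡ , λ f → IsEquivalence.trans ≐-isEquivalence (⊛-comm f qone) (⊛-identityˡ f)
    ; distrib = ⊛-distribˡ-⊕ , λ f g h → pointwise λ b →
        trans (coeff (⊛-comm (g ⊕ h) f) b)
              (trans (coeff (⊛-distribˡ-⊕ f g h) b)
                     (cong₂ _+_ (coeff (⊛-comm f g) b) (coeff (⊛-comm f h) b)))
    }
  ; *-comm = ⊛-comm
  }

ℤ[[q]] : CommutativeRing 0ℓ 0ℓ
ℤ[[q]] = record { isCommutativeRing = ℤ[[q]]-isCommutativeRing }

open CommutativeRing ℤ[[q]]
  using ()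
  renaming (zeroˡ to ⊛-zeroˡ; zeroʳ to ⊛-zeroʳ; +-identityˡ to ⊕-identityˡ; +-identityʳ to ⊕-identityʳ; *-identityʳ to ⊛-identityʳ;
            setoid to ≐-setoid; refl to ≐-refl; -‿inverseʳ to ⊝-inverseʳ; sym to ≐-sym; trans to ≐-trans; +-cong to ⊕-cong; -‿cong to ⊝-cong)

-- The solver below works over ℤ embedded as constant series.
constant : ℤ → QS
constant c b = if b ≡ᵇ 0 then c else 0ℤ

constant-homomorphism : ACR._-Raw-AlmostCommutative⟶_ ℤ.+-*-rawRing (ACR.fromCommutativeRing ℤ[[q]])
constant-homomorphism = record
  { ⟦_⟧    = constant
  ; +-homo = λ _ _ → pointwise λ { zero → refl ; (suc b) → refl }
  ; *-homo = λ c d → pointwise λ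
      { zero    → sym (ℤ.+-identityˡ (c * d))
      ; (suc b) → sym (sumTo-zero (suc (suc b)) λ { zero _ → ℤ.*-zeroʳ c ; (suc j) _ → refl })
      }
  ; -‿homo = λ _ → pointwise λ { zero → refl ; (suc b) → refl }
  ; 0-homo = pointwise λ { zero → refl ; (suc b) → refl }
  ; 1-homo = pointwise λ { zero → refl ; (suc b) → refl }
  }

constant-≟ : ∀ c d → Maybe (constant c ≐ constant d)
constant-≟ c d with c ℤ.≟ d
... | yes refl = just ≐-refl
... | no  _    = nothing

open import Algebra.Solver.Ring ℤ.+-*-rawRing (ACR.fromCommutativeRing ℤ[[q]]) constant-homomorphism constant-≟
  using (solve; _:+_; _:*_; _:-_; _:=_; con)

module ≐-Reasoning = Relation.Binary.Reasoning.Setoid ≐-setoid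

shift-cong : ∀ e {f g} → f ≐ g → shift e f ≐ shift e g
shift-cong e f≐g = pointwise λ b → cong (if e ≤ᵇ b then_else 0ℤ) (coeff f≐g (b ∸ e))

shift-zero : ∀ e → shift e qzero ≐ qzero
shift-zero e = pointwise coefficient
  where
  coefficient : ∀ b → shift e qzero b ≡ 0ℤ
  coefficient b with e ≤ᵇ b
  ... | true  = refl
  ... | false = refl

shift-shift : ∀ d e f → shift d (shift e f) ≐ shift (d +ℕ e) f
shift-shift d e f = pointwise coefficient
  where
  coefficient : ∀ b → shift d (shift e f) b ≡ shift (d +ℕ e) f b
  coefficient b with d ≤? b
  ... | no d≰b rewrite ≤ᵇ-false d≰b | ≤ᵇ-false {d +ℕ e} {b} (d≰b ∘ ℕ.≤-trans (ℕ.m≤m+n d e)) = refl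
  ... | yes d≤b rewrite ≤ᵇ-true d≤b with e ≤? b ∸ d
  ...   | yes e≤b-d rewrite ≤ᵇ-true e≤b-d | ≤ᵇ-true (subst (d +ℕ e ≤_) (ℕ.m+[n∸m]≡n d≤b) (ℕ.+-monoʳ-≤ d e≤b-d)) =
    cong f (ℕ.∸-+-assoc b d e)
  ...   | no  e≰b-d rewrite ≤ᵇ-false e≰b-d | ≤ᵇ-false {d +ℕ e} {b} (e≰b-d ∘ λ d+e≤b → subst (_≤ b ∸ d) (ℕ.m+n∸m≡n d e) (ℕ.∸-monoˡ-≤ d d+e≤b)) = refl

⊖-cong : ∀ {f f′ g g′} → f ≐ f′ → g ≐ g′ → f ⊖ g ≐ f′ ⊖ g′
⊖-cong f≐f′ g≐g′ = ⊕-cong f≐f′ (⊝-cong g≐g′)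

≡⇒≐ : ∀ {f g} → f ≡ g → f ≐ g
≡⇒≐ refl = ≐-refl

scale-cong : ∀ σ {f g} → f ≐ g → scale σ f ≐ scale σ g
scale-cong σ f≐g = pointwise λ b → cong (σ *_) (coeff f≐g b)

shift-scale : ∀ d σ f → shift d (scale σ f) ≐ scale σ (shift d f)
shift-scale d σ f = pointwise coefficient
  where
  coefficient : ∀ b → shift d (scale σ f) b ≡ scale σ (shift d f) b
  coefficient b with d ≤ᵇ b
  ... | true  = refl
  ... | false = sym (ℤ.*-zeroʳ σ)

scale-shift-zero : ∀ σ e → scale σ (shift e qzero) ≐ qzero
scale-shift-zero σ e = pointwise λ b → trans (cong (σ *_) (coeff (shift-zero e) b)) (ℤ.*-zeroʳ σ)

shift-scale-shift : ∀ d σ e e′ d′ f → d +ℕ e ≡ e′ +ℕ d′ →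
  shift d (scale σ (shift e f)) ≐ scale σ (shift e′ (shift d′ f))
shift-scale-shift d σ e e′ d′ f exponent = begin
  shift d (scale σ (shift e f))   ≈⟨ shift-scale d σ (shift e f) ⟩
  scale σ (shift d (shift e f))   ≈⟨ scale-cong σ (shift-shift d e f) ⟩
  scale σ (shift (d +ℕ e) f)      ≈⟨ scale-cong σ (≡⇒≐ (cong (λ d → shift d f) exponent)) ⟩
  scale σ (shift (e′ +ℕ d′) f)    ≈⟨ scale-cong σ (shift-shift e′ d′ f) ⟨
  scale σ (shift e′ (shift d′ f)) ∎
  where open ≐-Reasoning

scale-shift-distrib : ∀ σ e x y z w →
  scale σ (shift e x) ⊖ scale σ (shift e y) ⊖ scale σ (shift e z) ⊕ ⊝ scale σ (shift e w)
    ≐ scale σ (shift e (x ⊖ y ⊖ z ⊖ w))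
scale-shift-distrib σ e x y z w = pointwise coefficient
  where
  distrib : ∀ σ p q r s → σ * p - σ * q - σ * r + - (σ * s) ≡ σ * (p - q - r - s)
  distrib = ℤ-Solver.solve-∀
  coefficient : ∀ b → (scale σ (shift e x) ⊖ scale σ (shift e y) ⊖ scale σ (shift e z) ⊕ ⊝ scale σ (shift e w)) b
                    ≡ scale σ (shift e (x ⊖ y ⊖ z ⊖ w)) b
  coefficient b with e ≤ᵇ b
  ... | true  = distrib σ (x (b ∸ e)) (y (b ∸ e)) (z (b ∸ e)) (w (b ∸ e))
  ... | false = distrib σ 0ℤ 0ℤ 0ℤ 0ℤ

qmono-⊛-qmono : ∀ d e → qmono d ⊛ qmono e ≐ qmono (d +ℕ e)
qmono-⊛-qmono d e = begin
  qmono d ⊛ qmono e           ≈⟨ ⊛-cong (≐-refl {qmono d}) (⊛-identityʳ (qmono e)) ⟨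
  qmono d ⊛ (qmono e ⊛ qone)  ≈⟨ ≐-trans (qmono-⊛ d (qmono e ⊛ qone)) (shift-cong d (qmono-⊛ e qone)) ⟩
  shift d (shift e qone)      ≈⟨ shift-shift d e qone ⟩
  shift (d +ℕ e) qone         ≈⟨ qmono-⊛ (d +ℕ e) qone ⟨
  qmono (d +ℕ e) ⊛ qone       ≈⟨ ⊛-identityʳ (qmono (d +ℕ e)) ⟩
  qmono (d +ℕ e)              ∎
  where open ≐-Reasoning

-- Gaussian binomials

invApprox-stable : ∀ f n j → j ≤ n → invApprox f n j ≡ qinv f j
invApprox-stable f zero    zero z≤n = refl
invApprox-stable f (suc n) j j≤1+n with j ≤? n
... | yes j≤n rewrite ≤ᵇ-true j≤n = invApprox-stable f n j j≤n
... | no  j≰n with ℕ.m≤n⇒m<n∨m≡n j≤1+n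
...   | inj₁ j<1+n = contradiction (ℕ.m<1+n⇒m≤n j<1+n) j≰n
...   | inj₂ refl  = refl

qinv-suc : ∀ f n → qinv f (suc n) ≡ - sumTo (suc n) (λ t → f (suc n ∸ t) * qinv f t)
qinv-suc f n rewrite ≤ᵇ-false {suc n} {n} (ℕ.<-irrefl refl) | ≡ᵇ-true {n} refl =
  cong -_ (sumTo-cong (suc n) (λ t t<1+n → cong (f (suc n ∸ t) *_) (invApprox-stable f n t (ℕ.m<1+n⇒m≤n t<1+n))))

qinv-⊛ : ∀ f → f 0 ≡ 1ℤ → qinv f ⊛ f ≐ qone
qinv-⊛ f f0≡1 = pointwise coefficient
  where
  coefficient : ∀ b → (qinv f ⊛ f) b ≡ qone b
  coefficient zero rewrite f0≡1 = refl
  coefficient (suc n) rewrite ℕ.n∸n≡0 n | f0≡1 = begin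
      sumTo (suc n) (λ j → qinv f j * f (suc n ∸ j)) + qinv f (suc n) * 1ℤ
    ≡⟨ cong₂ _+_ (sumTo-cong (suc n) (λ j _ → ℤ.*-comm (qinv f j) _))
                 (trans (ℤ.*-identityʳ _) (qinv-suc f n)) ⟩
      S + - S
    ≡⟨ ℤ.+-inverseʳ S ⟩
      0ℤ
    ∎
    where
    open ≡-Reasoning
    S = sumTo (suc n) (λ t → f (suc n ∸ t) * qinv f t)

gauss : ℕ → ℕ → ℕ → QS
gauss s a       zero    = qone
gauss s zero    (suc B) = qzero
gauss s (suc a) (suc B) = gauss s a B ⊕ qmono (s *ℕ suc B) ⊛ gauss s a (suc B)

gauss-above : ∀ s a B → a < B → gauss s a B ≐ qzero
gauss-above s zero    (suc B) _         = ≐-refl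
gauss-above s (suc a) (suc B) (s≤s a<B) = begin
  gauss s a B ⊕ qmono (s *ℕ suc B) ⊛ gauss s a (suc B)
    ≈⟨ ⊕-cong (gauss-above s a B a<B) (⊛-cong (≐-refl {qmono (s *ℕ suc B)}) (gauss-above s a (suc B) (ℕ.m<n⇒m<1+n a<B))) ⟩
  qzero ⊕ qmono (s *ℕ suc B) ⊛ qzero
    ≈⟨ ≐-trans (⊕-identityˡ (qmono (s *ℕ suc B) ⊛ qzero)) (⊛-zeroʳ (qmono (s *ℕ suc B))) ⟩
  qzero ∎
  where open ≐-Reasoning

poch-⊛-gauss : ∀ s a B → B ≤ a → poch s B ⊛ poch s (a ∸ B) ⊛ gauss s a B ≐ poch s a
poch-⊛-gauss-suc : ∀ s a B → B ≤ a →
  poch s (suc B) ⊛ poch s (a ∸ B) ⊛ gauss s a (suc B) ≐ (qone ⊖ qmono (s *ℕ (a ∸ B))) ⊛ poch s a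

poch-⊛-gauss s a       zero    _          = ≐-trans (⊛-identityʳ _) (⊛-identityˡ (poch s a))
poch-⊛-gauss s (suc a) (suc B) (s≤s B≤a) = begin
  P ⊛ (qone ⊖ u) ⊛ Q ⊛ (gauss s a B ⊕ u ⊛ gauss s a (suc B))
    ≈⟨ solve 5 (λ P Q u g₁ g₂ → P :* (con (+ 1) :- u) :* Q :* (g₁ :+ u :* g₂)
                 := (con (+ 1) :- u) :* (P :* Q :* g₁) :+ u :* (P :* (con (+ 1) :- u) :* Q :* g₂))
               ≐-refl P Q u (gauss s a B) (gauss s a (suc B)) ⟩
  (qone ⊖ u) ⊛ (P ⊛ Q ⊛ gauss s a B) ⊕ u ⊛ (poch s (suc B) ⊛ Q ⊛ gauss s a (suc B))
    ≈⟨ ⊕-cong (⊛-cong (≐-refl {qone ⊖ u}) (poch-⊛-gauss s a B B≤a)) (⊛-cong (≐-refl {u}) (poch-⊛-gauss-suc s a B B≤a)) ⟩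
  (qone ⊖ u) ⊛ poch s a ⊕ u ⊛ ((qone ⊖ v) ⊛ poch s a)
    ≈⟨ solve 3 (λ R u v → (con (+ 1) :- u) :* R :+ u :* ((con (+ 1) :- v) :* R)
                 := R :* (con (+ 1) :- u :* v)) ≐-refl (poch s a) u v ⟩
  poch s a ⊛ (qone ⊖ u ⊛ v)
    ≈⟨ ⊛-cong (≐-refl {poch s a}) (⊖-cong (≐-refl {qone}) (≐-trans (qmono-⊛-qmono _ _) (≡⇒≐ (cong qmono exponent)))) ⟩
  poch s (suc a) ∎
  where
  open ≐-Reasoning
  P = poch s B
  Q = poch s (a ∸ B)
  u = qmono (s *ℕ suc B)
  v = qmono (s *ℕ (a ∸ B))
  exponent : s *ℕ suc B +ℕ s *ℕ (a ∸ B) ≡ s *ℕ suc a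
  exponent = trans (sym (ℕ.*-distribˡ-+ s (suc B) (a ∸ B))) (cong (λ n → s *ℕ suc n) (ℕ.m+[n∸m]≡n B≤a))

poch-⊛-gauss-suc s a B B≤a with ℕ.m≤n⇒m<n∨m≡n B≤a
... | inj₂ refl rewrite ℕ.n∸n≡0 B | ℕ.*-zeroʳ s = begin
  poch s (suc B) ⊛ poch s 0 ⊛ gauss s B (suc B) ≈⟨ ⊛-cong (≐-refl {poch s (suc B) ⊛ poch s 0}) (gauss-above s B (suc B) ℕ.≤-refl) ⟩
  poch s (suc B) ⊛ poch s 0 ⊛ qzero             ≈⟨ ⊛-zeroʳ (poch s (suc B) ⊛ poch s 0) ⟩
  qzero                                         ≈⟨ ⊛-zeroˡ (poch s B) ⟨
  qzero ⊛ poch s B                              ≈⟨ ⊛-cong (⊝-inverseʳ qone) (≐-refl {poch s B}) ⟨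
  (qone ⊖ qone) ⊛ poch s B                      ∎
  where open ≐-Reasoning
... | inj₁ B<a rewrite ℕ.+-∸-assoc 1 B<a = begin
  poch s (suc B) ⊛ (Q ⊛ (qone ⊖ v)) ⊛ gauss s a (suc B)
    ≈⟨ solve 4 (λ P Q v g → P :* (Q :* (con (+ 1) :- v)) :* g := (con (+ 1) :- v) :* (P :* Q :* g))
               ≐-refl (poch s (suc B)) Q v (gauss s a (suc B)) ⟩
  (qone ⊖ v) ⊛ (poch s (suc B) ⊛ Q ⊛ gauss s a (suc B))
    ≈⟨ ⊛-cong (≐-refl {qone ⊖ v}) (poch-⊛-gauss s a (suc B) B<a) ⟩
  (qone ⊖ v) ⊛ poch s a ∎
  where
  open ≐-Reasoning
  Q = poch s (a ∸ suc B)
  v = qmono (s *ℕ suc (a ∸ suc B))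

poch-constant : ∀ s n → poch (suc s) n 0 ≡ 1ℤ
poch-constant s zero = refl
poch-constant s (suc n) rewrite poch-constant s n = refl

gaussNat≐gauss : ∀ s a B → B ≤ a → gaussNat (suc s) a B ≐ gauss (suc s) a B
gaussNat≐gauss s a B B≤a = begin
  poch (suc s) a ⊛ qinv D  ≈⟨ ⊛-cong (poch-⊛-gauss (suc s) a B B≤a) (≐-refl {qinv D}) ⟨
  D ⊛ g ⊛ qinv D           ≈⟨ solve 3 (λ D g I → D :* g :* I := g :* (I :* D)) ≐-refl D g (qinv D) ⟩
  g ⊛ (qinv D ⊛ D)         ≈⟨ ⊛-cong (≐-refl {g}) (qinv-⊛ D D0≡1) ⟩
  g ⊛ qone                 ≈⟨ ⊛-identityʳ g ⟩
  g                        ∎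
  where
  open ≐-Reasoning
  D = poch (suc s) B ⊛ poch (suc s) (a ∸ B)
  g = gauss (suc s) a B
  D0≡1 : D 0 ≡ 1ℤ
  D0≡1 rewrite poch-constant s B | poch-constant s (a ∸ B) = refl

gaussℤ : ℕ → ℤ → ℕ → QS
gaussℤ s (+ a)    B = gauss s a B
gaussℤ s -[1+ _ ] B = qzero

qbin≐gaussℤ : ∀ s A B → 1 ≤ s → qbin s A B ≐ gaussℤ s A B
qbin≐gaussℤ s       -[1+ _ ] B _         = ≐-refl
qbin≐gaussℤ (suc s) (+ a)    B (s≤s z≤n) with B ≤? a
... | yes B≤a rewrite ≤ᵇ-true B≤a = gaussNat≐gauss s a B B≤a
... | no  B≰a rewrite ≤ᵇ-false B≰a = ≐-sym (gauss-above (suc s) a B (ℕ.≰⇒> B≰a))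

gaussℤ-zero-top : ∀ s {A} m → A ≡ 0ℤ → m ≢ 0 → gaussℤ s A m ≐ qzero
gaussℤ-zero-top s zero    _    m≢0 = contradiction refl m≢0
gaussℤ-zero-top s (suc m) refl _   = ≐-refl

-- [A - 1, B - 1], read as 0 when B = 0
gaussℤ-pred : ℕ → ℤ → ℕ → QS
gaussℤ-pred s A zero    = qzero
gaussℤ-pred s A (suc B) = gaussℤ s (A - 1ℤ) B

gaussℤ-pascal : ∀ s A B → (A ≡ 0ℤ → B ≢ 0) →
  gaussℤ s A B ≐ gaussℤ-pred s A B ⊕ qmono (s *ℕ B) ⊛ gaussℤ s (A - 1ℤ) B
gaussℤ-pascal s -[1+ _ ]    zero    _   = ≐-sym (≐-trans (⊕-identityˡ _) (⊛-zeroʳ (qmono (s *ℕ 0))))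
gaussℤ-pascal s -[1+ _ ]    (suc B) _   = ≐-sym (≐-trans (⊕-identityˡ _) (⊛-zeroʳ (qmono (s *ℕ suc B))))
gaussℤ-pascal s (+ zero)    zero    A≢0 = contradiction refl (A≢0 refl)
gaussℤ-pascal s (+ zero)    (suc B) _   = ≐-sym (≐-trans (⊕-identityˡ _) (⊛-zeroʳ (qmono (s *ℕ suc B))))
gaussℤ-pascal s (+ suc a)   zero    _   rewrite ℕ.*-zeroʳ s = ≐-sym (≐-trans (⊕-identityˡ _) (⊛-identityˡ qone))
gaussℤ-pascal s (+ suc a)   (suc B) _   = ≐-refl

pascal-defect : ∀ {x} y z → x ≐ y ⊕ z → x ⊖ y ⊖ z ≐ qzero
pascal-defect {x} y z x≐y+z = begin
  x ⊖ y ⊖ z        ≈⟨ ⊖-cong (⊖-cong x≐y+z (≐-refl {y})) (≐-refl {z}) ⟩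
  y ⊕ z ⊖ y ⊖ z    ≈⟨ solve 2 (λ y z → y :+ z :- y :- z := y :- y) ≐-refl y z ⟩
  y ⊖ y            ≈⟨ ⊝-inverseʳ y ⟩
  qzero            ∎
  where open ≐-Reasoning

-- Each hypothesis is Pascal's rule for one factor or, in the corner [0, 0] where the rule fails,
-- a vanishing factor that makes it unnecessary.
pascal-product : ∀ a₁ a₀ p b₁ b₀ r u v →
  a₁ ≐ qzero ⊎ b₁ ≐ r ⊕ v ⊛ b₀ → a₁ ≐ p ⊕ u ⊛ a₀ ⊎ b₀ ≐ qzero →
  a₁ ⊛ b₁ ⊖ (u ⊛ v) ⊛ (a₀ ⊛ b₀) ⊖ v ⊛ (p ⊛ b₀) ⊖ a₁ ⊛ r ≐ qzero
pascal-product a₁ a₀ p b₁ b₀ r u v first second = begin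
  a₁ ⊛ b₁ ⊖ (u ⊛ v) ⊛ (a₀ ⊛ b₀) ⊖ v ⊛ (p ⊛ b₀) ⊖ a₁ ⊛ r
    ≈⟨ solve 8 (λ a₁ a₀ p b₁ b₀ r u v →
         a₁ :* b₁ :- (u :* v) :* (a₀ :* b₀) :- v :* (p :* b₀) :- a₁ :* r
         := a₁ :* (b₁ :- r :- v :* b₀) :+ (a₁ :- p :- u :* a₀) :* (v :* b₀))
       ≐-refl a₁ a₀ p b₁ b₀ r u v ⟩
  a₁ ⊛ (b₁ ⊖ r ⊖ v ⊛ b₀) ⊕ (a₁ ⊖ p ⊖ u ⊛ a₀) ⊛ (v ⊛ b₀)
    ≈⟨ ⊕-cong (first-vanishes first) (second-vanishes second) ⟩
  qzero ⊕ qzero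
    ≈⟨ ⊕-identityˡ qzero ⟩
  qzero ∎
  where
  open ≐-Reasoning
  first-vanishes : a₁ ≐ qzero ⊎ b₁ ≐ r ⊕ v ⊛ b₀ → a₁ ⊛ (b₁ ⊖ r ⊖ v ⊛ b₀) ≐ qzero
  first-vanishes (inj₁ a₁≐0) = ≐-trans (⊛-cong a₁≐0 (≐-refl {b₁ ⊖ r ⊖ v ⊛ b₀})) (⊛-zeroˡ (b₁ ⊖ r ⊖ v ⊛ b₀))
  first-vanishes (inj₂ b-rule) = ≐-trans (⊛-cong (≐-refl {a₁}) (pascal-defect r (v ⊛ b₀) b-rule)) (⊛-zeroʳ a₁)
  second-vanishes : a₁ ≐ p ⊕ u ⊛ a₀ ⊎ b₀ ≐ qzero → (a₁ ⊖ p ⊖ u ⊛ a₀) ⊛ (v ⊛ b₀) ≐ qzero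
  second-vanishes (inj₁ a-rule) = ≐-trans (⊛-cong (pascal-defect p (u ⊛ a₀) a-rule) (≐-refl {v ⊛ b₀})) (⊛-zeroˡ (v ⊛ b₀))
  second-vanishes (inj₂ b₀≐0) =
    ≐-trans (⊛-cong (≐-refl {a₁ ⊖ p ⊖ u ⊛ a₀}) (≐-trans (⊛-cong (≐-refl {v}) b₀≐0) (⊛-zeroʳ v))) (⊛-zeroʳ (a₁ ⊖ p ⊖ u ⊛ a₀))

-- Double series

sumQ : ℕ → (ℕ → QS) → QS
sumQ L h b = sumTo L (λ n → h n b)

infixl 5 _when_
_when_ : QS → Bool → QS
(f when c) b = if c then f b else 0ℤ

sumQ-cong : ∀ L {g h : ℕ → QS} → (∀ n → n < L → g n ≐ h n) → sumQ L g ≐ sumQ L h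
sumQ-cong L g≐h = pointwise λ b → sumTo-cong L (λ n n<L → coeff (g≐h n n<L) b)

sumQ-⊕ : ∀ L g h → sumQ L g ⊕ sumQ L h ≐ sumQ L (λ n → g n ⊕ h n)
sumQ-⊕ L g h = pointwise λ b → sym (sumTo-+ L (λ n → g n b) (λ n → h n b))

sumQ-⊝ : ∀ L h → ⊝ sumQ L h ≐ sumQ L (λ n → ⊝ h n)
sumQ-⊝ L h = pointwise λ b → sym (sumTo-neg L (λ n → h n b))

sumQ-head : ∀ L h → sumQ (suc L) h ≐ h 0 ⊕ sumQ L (h ∘ suc)
sumQ-head L h = pointwise λ b → sumTo-head L (λ n → h n b)

shift-sumQ : ∀ e L h → shift e (sumQ L h) ≐ sumQ L (λ n → shift e (h n))
shift-sumQ e L h = pointwise coefficient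
  where
  coefficient : ∀ b → shift e (sumQ L h) b ≡ sumQ L (λ n → shift e (h n)) b
  coefficient b with e ≤ᵇ b
  ... | true  = refl
  ... | false = sym (sumTo-zero L (λ _ _ → refl))

shift-when : ∀ e f c → shift e (f when c) ≐ shift e f when c
shift-when e f true  = ≐-refl
shift-when e f false = pointwise coefficient
  where
  coefficient : ∀ b → shift e (f when false) b ≡ 0ℤ
  coefficient b with e ≤ᵇ b
  ... | true  = refl
  ... | false = refl

when-≤ᵇ-cong : ∀ x a {f g} → (x ≤ a → f ≐ g) → f when (x ≤ᵇ a) ≐ g when (x ≤ᵇ a)
when-≤ᵇ-cong x a f≐g with x ≤? a
... | yes x≤a rewrite ≤ᵇ-true x≤a = f≐g x≤a
... | no  x≰a rewrite ≤ᵇ-false x≰a = ≐-refl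

when-≤ᵇ-false : ∀ {x a} f → x ≰ a → f when (x ≤ᵇ a) ≐ qzero
when-≤ᵇ-false f x≰a rewrite ≤ᵇ-false x≰a = ≐-refl

when-cong : ∀ c {f g} → f ≐ g → f when c ≐ g when c
when-cong true  f≐g = f≐g
when-cong false f≐g = ≐-refl

qzero-when : ∀ c → qzero when c ≐ qzero
qzero-when true  = ≐-refl
qzero-when false = ≐-refl

-- blocks K c is the power series in x whose coefficient of x^a is the sum of c m n over m + K n = a.
block : ℕ → (ℕ → ℕ → QS) → ℕ → ℕ → QS
block K c a n = c (a ∸ K *ℕ n) n when (K *ℕ n ≤ᵇ a)

blocks : ℕ → (ℕ → ℕ → QS) → ℕ → QS
blocks K c a = sumQ (suc a) (block K c a)

-- The families of x q^d · S and of x^K q^d · S, when c is the family of S.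
mulX : ℕ → (ℕ → ℕ → QS) → ℕ → ℕ → QS
mulX d c zero    n = qzero
mulX d c (suc m) n = shift d (c m n)

mulXᴷ : ℕ → (ℕ → ℕ → QS) → ℕ → ℕ → QS
mulXᴷ d c m zero    = qzero
mulXᴷ d c m (suc n) = shift d (c m n)

module _ (K : ℕ) where

  blocks-⊕ : ∀ c d a → blocks K c a ⊕ blocks K d a ≐ blocks K (λ m n → c m n ⊕ d m n) a
  blocks-⊕ c d a = ≐-trans (sumQ-⊕ (suc a) (block K c a) (block K d a)) (sumQ-cong (suc a) λ n _ →
    pointwise λ b → sym (if-float-+ (K *ℕ n ≤ᵇ a)))
    where
    if-float-+ : ∀ {x y} c → (if c then x + y else 0ℤ) ≡ (if c then x else 0ℤ) + (if c then y else 0ℤ)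
    if-float-+ true  = refl
    if-float-+ false = refl

  blocks-⊝ : ∀ c a → ⊝ blocks K c a ≐ blocks K (λ m n → ⊝ c m n) a
  blocks-⊝ c a = ≐-trans (sumQ-⊝ (suc a) (block K c a)) (sumQ-cong (suc a) λ n _ →
    pointwise λ b → sym (if-float-neg (K *ℕ n ≤ᵇ a)))
    where
    if-float-neg : ∀ {x} c → (if c then - x else 0ℤ) ≡ - (if c then x else 0ℤ)
    if-float-neg true  = refl
    if-float-neg false = refl

  blocks-zero : ∀ c a → (∀ m n → c m n ≐ qzero) → blocks K c a ≐ qzero
  blocks-zero c a c≐0 = pointwise λ b → sumTo-zero (suc a) λ n _ →
    coeff (≐-trans (when-≤ᵇ-cong (K *ℕ n) a (λ _ → c≐0 (a ∸ K *ℕ n) n)) (qzero-when (K *ℕ n ≤ᵇ a))) b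

  blocks-shift : ∀ r c a → shift (r *ℕ a) (blocks K c a) ≐ blocks K (λ m n → shift (r *ℕ (m +ℕ K *ℕ n)) (c m n)) a
  blocks-shift r c a = ≐-trans (shift-sumQ (r *ℕ a) (suc a) (block K c a)) (sumQ-cong (suc a) λ n _ →
    ≐-trans (shift-when (r *ℕ a) (c (a ∸ K *ℕ n) n) (K *ℕ n ≤ᵇ a)) (when-≤ᵇ-cong (K *ℕ n) a λ Kn≤a →
      pointwise λ b → cong (λ e → shift (r *ℕ e) (c (a ∸ K *ℕ n) n) b) (sym (ℕ.m∸n+n≡m Kn≤a))))

  blocks-⊖ : ∀ c d a → blocks K c a ⊖ blocks K d a ≐ blocks K (λ m n → c m n ⊖ d m n) a
  blocks-⊖ c d a = ≐-trans (⊕-cong (≐-refl {blocks K c a}) (blocks-⊝ d a)) (blocks-⊕ c (λ m n → ⊝ d m n) a)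

  blocks-combination : ∀ c₁ c₂ c₃ c₄ a →
    blocks K c₁ a ⊖ blocks K c₂ a ⊖ blocks K c₃ a ⊕ blocks K c₄ a
      ≐ blocks K (λ m n → c₁ m n ⊖ c₂ m n ⊖ c₃ m n ⊕ c₄ m n) a
  blocks-combination c₁ c₂ c₃ c₄ a =
    ≐-trans (⊕-cong (≐-trans (⊖-cong (blocks-⊖ c₁ c₂ a) (≐-refl {blocks K c₃ a})) (blocks-⊖ c₁₂ c₃ a)) (≐-refl {blocks K c₄ a}))
            (blocks-⊕ (λ m n → c₁₂ m n ⊖ c₃ m n) c₄ a)
    where
    c₁₂ : ℕ → ℕ → QS
    c₁₂ m n = c₁ m n ⊖ c₂ m n

  shift-block-mulX : ∀ d c a n → shift d (block K c a n) ≐ block K (mulX d c) (suc a) n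
  shift-block-mulX d c a n with K *ℕ n ≤? a
  ... | yes Kn≤a rewrite ≤ᵇ-true Kn≤a | ≤ᵇ-true (ℕ.m≤n⇒m≤1+n Kn≤a) | ℕ.+-∸-assoc 1 Kn≤a = ≐-refl
  ... | no  Kn≰a rewrite ≤ᵇ-false Kn≰a = ≐-trans (shift-when d (c (a ∸ K *ℕ n) n) false) (≐-sym boundary)
    where
    boundary : block K (mulX d c) (suc a) n ≐ qzero
    boundary with K *ℕ n ≤? suc a
    ... | no  Kn≰1+a = when-≤ᵇ-false (mulX d c (suc a ∸ K *ℕ n) n) Kn≰1+a
    ... | yes Kn≤1+a with ℕ.m≤n⇒m<n∨m≡n Kn≤1+a
    ...   | inj₁ Kn<1+a = contradiction (ℕ.m<1+n⇒m≤n Kn<1+a) Kn≰a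
    ...   | inj₂ Kn≡1+a rewrite Kn≡1+a | ℕ.n∸n≡0 a | ≤ᵇ-true (ℕ.≤-refl {suc a}) = ≐-refl

  shift-block-mulXᴷ : ∀ d c a n → K ≤ a → shift d (block K c (a ∸ K) n) ≐ block K (mulXᴷ d c) a (suc n)
  shift-block-mulXᴷ d c a n K≤a rewrite ℕ.*-suc K n | sym (ℕ.∸-+-assoc a K (K *ℕ n)) | sym (≤ᵇ-∸ (K *ℕ n) K≤a) =
    shift-when d (c (a ∸ K ∸ K *ℕ n) n) (K *ℕ n ≤ᵇ a ∸ K)

  module _ (1≤K : 1 ≤ K) where

    n≤Kn : ∀ n → n ≤ K *ℕ n
    n≤Kn n = subst (_≤ K *ℕ n) (ℕ.*-identityˡ n) (ℕ.*-monoˡ-≤ n 1≤K)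

    blocks-long : ∀ c a L → suc a ≤ L → blocks K c a ≐ sumQ L (block K c a)
    blocks-long c a L a<L = pointwise λ b → sumTo-extend (suc a) L _ a<L λ n a<n _ →
      coeff (when-≤ᵇ-false (c (a ∸ K *ℕ n) n) (λ Kn≤a → ℕ.<-irrefl refl (ℕ.≤-trans a<n (ℕ.≤-trans (n≤Kn n) Kn≤a)))) b

    blocks-mulX : ∀ d c a → shift d (blocks K c (a ∸ 1)) when (1 ≤ᵇ a) ≐ blocks K (mulX d c) a
    blocks-mulX d c zero = ≐-sym (pointwise λ b → sumTo-zero 1 λ n _ → coeff (empty n) b)
      where
      empty : ∀ n → block K (mulX d c) 0 n ≐ qzero
      empty n rewrite ℕ.0∸n≡0 (K *ℕ n) = qzero-when (K *ℕ n ≤ᵇ 0)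
    blocks-mulX d c (suc a) = begin
      shift d (blocks K c a)                          ≈⟨ shift-cong d (blocks-long c a (suc (suc a)) (ℕ.n≤1+n (suc a))) ⟩
      shift d (sumQ (suc (suc a)) (block K c a))      ≈⟨ shift-sumQ d (suc (suc a)) (block K c a) ⟩
      sumQ (suc (suc a)) (shift d ∘ block K c a)      ≈⟨ sumQ-cong (suc (suc a)) (λ n _ → shift-block-mulX d c a n) ⟩
      blocks K (mulX d c) (suc a)                     ∎
      where open ≐-Reasoning

    blocks-mulXᴷ : ∀ d c a → shift d (blocks K c (a ∸ K)) when (K ≤ᵇ a) ≐ blocks K (mulXᴷ d c) a
    blocks-mulXᴷ d c a = begin
      shift d (blocks K c (a ∸ K)) when (K ≤ᵇ a)                          ≈⟨ tail (K ≤? a) ⟩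
      sumQ a (block K (mulXᴷ d c) a ∘ suc)                                ≈⟨ ⊕-identityˡ _ ⟨
      qzero ⊕ sumQ a (block K (mulXᴷ d c) a ∘ suc)                        ≈⟨ ⊕-cong (qzero-when (K *ℕ 0 ≤ᵇ a)) ≐-refl ⟨
      block K (mulXᴷ d c) a 0 ⊕ sumQ a (block K (mulXᴷ d c) a ∘ suc)      ≈⟨ sumQ-head a (block K (mulXᴷ d c) a) ⟨
      blocks K (mulXᴷ d c) a                                              ∎
      where
      open ≐-Reasoning
      tail : Dec (K ≤ a) → shift d (blocks K c (a ∸ K)) when (K ≤ᵇ a) ≐ sumQ a (block K (mulXᴷ d c) a ∘ suc)
      tail (no K≰a) = ≐-trans (when-≤ᵇ-false _ K≰a) (≐-sym (pointwise λ b → sumTo-zero a λ n _ →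
        coeff (when-≤ᵇ-false (mulXᴷ d c (a ∸ K *ℕ suc n) (suc n)) (K≰a ∘ ℕ.≤-trans (ℕ.m≤m*n K (suc n)))) b))
      tail (yes K≤a) rewrite ≤ᵇ-true K≤a = begin
        shift d (blocks K c (a ∸ K))               ≈⟨ shift-cong d (blocks-long c (a ∸ K) a a-K<a) ⟩
        shift d (sumQ a (block K c (a ∸ K)))       ≈⟨ shift-sumQ d a (block K c (a ∸ K)) ⟩
        sumQ a (shift d ∘ block K c (a ∸ K))       ≈⟨ sumQ-cong a (λ n _ → shift-block-mulXᴷ d c a n K≤a) ⟩
        sumQ a (block K (mulXᴷ d c) a ∘ suc)       ∎
        where
        a-K<a : suc (a ∸ K) ≤ a
        a-K<a = ℕ.≤-trans (ℕ.+-monoˡ-≤ (a ∸ K) 1≤K) (ℕ.≤-reflexive (ℕ.m+[n∸m]≡n K≤a))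

-- The polynomials F_N(i,0,k;x)

sumTo-offset : ∀ a c (X : ℕ → ℤ) →
  sumTo (suc a) (λ m → if m +ℕ c ≡ᵇ a then X m else 0ℤ) ≡ (if c ≤ᵇ a then X (a ∸ c) else 0ℤ)
sumTo-offset a c X with c ≤? a
... | yes c≤a rewrite ≤ᵇ-true c≤a = trans
  (sumTo-cong (suc a) (λ m _ → cong (if_then X m else 0ℤ) (same-test m)))
  (sumTo-indicator (suc a) (a ∸ c) X (s≤s (ℕ.m∸n≤m a c)))
  where
  same-test : ∀ m → (m +ℕ c ≡ᵇ a) ≡ (m ≡ᵇ a ∸ c)
  same-test m with m ≟ a ∸ c
  ... | yes refl = trans (≡ᵇ-true (ℕ.m∸n+n≡m c≤a)) (sym (≡ᵇ-true {m} refl))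
  ... | no  m≢   = trans (≡ᵇ-false (λ m+c≡a → m≢ (trans (sym (ℕ.m+n∸n≡m m c)) (cong (_∸ c) m+c≡a)))) (sym (≡ᵇ-false m≢))
... | no  c≰a rewrite ≤ᵇ-false c≰a = sumTo-zero (suc a) λ m _ →
  cong (if_then X m else 0ℤ) (≡ᵇ-false (λ m+c≡a → c≰a (subst (c ≤_) m+c≡a (ℕ.m≤n+m c m))))

negative-minus-nat : ∀ j x → Σ ℕ (λ j′ → -[1+ j ] - + x ≡ -[1+ j′ ])
negative-minus-nat j zero    = j , refl
negative-minus-nat j (suc x) = suc (j +ℕ x) , refl

[1+n]C2 : ∀ n → suc n C 2 ≡ n +ℕ n C 2
[1+n]C2 n = trans (sym (nCk+nC[k+1]≡[n+1]C[k+1] n 1)) (cong (_+ℕ n C 2) (nC1≡n n))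

[m+n]C2 : ∀ m n → (m +ℕ n) C 2 ≡ m C 2 +ℕ n C 2 +ℕ m *ℕ n
[m+n]C2 zero    n = sym (ℕ.+-identityʳ (n C 2))
[m+n]C2 (suc m) n = begin
  suc (m +ℕ n) C 2                            ≡⟨ [1+n]C2 (m +ℕ n) ⟩
  m +ℕ n +ℕ (m +ℕ n) C 2                      ≡⟨ cong (m +ℕ n +ℕ_) ([m+n]C2 m n) ⟩
  m +ℕ n +ℕ (m C 2 +ℕ n C 2 +ℕ m *ℕ n)        ≡⟨ regroup m n (m C 2) (n C 2) ⟩
  m +ℕ m C 2 +ℕ n C 2 +ℕ suc m *ℕ n           ≡⟨ cong (λ c → c +ℕ n C 2 +ℕ suc m *ℕ n) ([1+n]C2 m) ⟨
  suc m C 2 +ℕ n C 2 +ℕ suc m *ℕ n            ∎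
  where
  open ≡-Reasoning
  regroup : ∀ m n x y → m +ℕ n +ℕ (x +ℕ y +ℕ m *ℕ n) ≡ m +ℕ x +ℕ y +ℕ suc m *ℕ n
  regroup = ℕ-Solver.solve-∀

difference-zero : ∀ x y z → + x - + y - + z ≡ 0ℤ → x ≡ y +ℕ z
difference-zero x y z eq = ℤ.+-injective (ℤ.i-j≡0⇒i≡j (+ x) (+ (y +ℕ z)) (trans (regroup (+ x) (+ y) (+ z)) eq))
  where
  regroup : ∀ a b c → a - (b + c) ≡ a - b - c
  regroup = ℤ-Solver.solve-∀

-- K, E and G are the local definitions of F, so that F i k (+ N) unfolds to a double sum of term.
module Recurrence (i k : ℕ) where

  K : ℕ
  K = 2 *ℕ k +ℕ 1

  1≤K : 1 ≤ K
  1≤K = ℕ.m≤n+m 1 (2 *ℕ k)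

  E : ℕ → ℕ → ℕ
  E n m = ((K *ℕ n +ℕ 1) C 2) +ℕ m *ℕ m +ℕ K *ℕ m *ℕ n +ℕ i *ℕ (m +ℕ n)

  topₘ topₙ : ℤ → ℕ → ℕ → ℤ
  topₘ N m n = N - + (K *ℕ n) - + m
  topₙ N m n = N - + (2 *ℕ k *ℕ n) - + m

  G : ℤ → ℕ → ℕ → QS
  G N n m = qbin 1 (topₘ N m n) m ⊛ qbin K (topₙ N m n) n

  term : ℤ → ℕ → ℕ → QS
  term N m n = scale (sgn n) (shift (E n m) (G N n m))

  term-negative : ∀ j m n → term -[1+ j ] m n ≐ qzero
  term-negative j m n with negative-minus-nat j (K *ℕ n)
  ... | j₁ , eq₁ rewrite eq₁ with negative-minus-nat j₁ m
  ...   | j₂ , eq₂ rewrite eq₂ =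
    ≐-trans (scale-cong (sgn n) (shift-cong (E n m) (⊛-zeroˡ (qbin K (topₙ -[1+ j ] m n) n))))
            (scale-shift-zero (sgn n) (E n m))

  F-blocks : ∀ N a → F i k N a ≐ blocks K (term N) a
  F-blocks (+ N)    a = pointwise λ b → sumTo-cong (suc a) λ n _ → sumTo-offset a (K *ℕ n) (λ m → term (+ N) m n b)
  F-blocks -[1+ j ] a = ≐-sym (blocks-zero K (term -[1+ j ]) a (term-negative j))

  D : ℕ
  D = ((2 *ℕ k +ℕ 2) C 2) +ℕ i

  family₁ family₂ family₃ family₄ : ℤ → ℕ → ℕ → QS
  family₁ N = term N
  family₂ N m n = shift (1 *ℕ (m +ℕ K *ℕ n)) (term (N - + 1) m n)
  family₃ N = mulX (i +ℕ 1) (λ m n → shift (2 *ℕ (m +ℕ K *ℕ n)) (term (N - + 2) m n))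
  family₄ N = mulXᴷ D (λ m n → shift (K *ℕ (m +ℕ K *ℕ n)) (term (N - + K) m n))

  subX-F : ∀ r N a → subX r (F i k N) a ≐ blocks K (λ m n → shift (r *ℕ (m +ℕ K *ℕ n)) (term N m n)) a
  subX-F r N a = ≐-trans (shift-cong (r *ℕ a) (F-blocks N a)) (blocks-shift K r (term N) a)

  LHS-blocks : ∀ N a →
    LHS i k N a ≐ blocks K (family₁ N) a ⊖ blocks K (family₂ N) a ⊖ blocks K (family₃ N) a ⊕ blocks K (family₄ N) a
  LHS-blocks N a = ⊕-cong (⊖-cong (⊖-cong (F-blocks N a) (subX-F 1 (N - + 1) a)) third) fourth
    where
    third : monoMul 1 (i +ℕ 1) (subX 2 (F i k (N - + 2))) a ≐ blocks K (family₃ N) a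
    third = ≐-trans (when-cong (1 ≤ᵇ a) (shift-cong (i +ℕ 1) (subX-F 2 (N - + 2) (a ∸ 1))))
                    (blocks-mulX K 1≤K (i +ℕ 1) (λ m n → shift (2 *ℕ (m +ℕ K *ℕ n)) (term (N - + 2) m n)) a)
    fourth : monoMul K D (subX K (F i k (N - + K))) a ≐ blocks K (family₄ N) a
    fourth = ≐-trans (when-cong (K ≤ᵇ a) (shift-cong D (subX-F K (N - + K) (a ∸ K))))
                     (blocks-mulXᴷ K 1≤K D (λ m n → shift (K *ℕ (m +ℕ K *ℕ n)) (term (N - + K) m n)) a)

  exponent₂ : ∀ n m → 1 *ℕ (m +ℕ K *ℕ n) +ℕ E n m ≡ E n m +ℕ (m +ℕ K *ℕ n)
  exponent₂ n m = trans (cong (_+ℕ E n m) (ℕ.*-identityˡ (m +ℕ K *ℕ n))) (ℕ.+-comm (m +ℕ K *ℕ n) (E n m))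

  exponent₃ : ∀ n m → i +ℕ 1 +ℕ 2 *ℕ (m +ℕ K *ℕ n) +ℕ E n m ≡ E n (suc m) +ℕ K *ℕ n
  exponent₃ n m = polynomial ((K *ℕ n +ℕ 1) C 2) i K n m
    where
    polynomial : ∀ c i K n m → i +ℕ 1 +ℕ 2 *ℕ (m +ℕ K *ℕ n) +ℕ (c +ℕ m *ℕ m +ℕ K *ℕ m *ℕ n +ℕ i *ℕ (m +ℕ n))
                             ≡ c +ℕ suc m *ℕ suc m +ℕ K *ℕ suc m *ℕ n +ℕ i *ℕ (suc m +ℕ n) +ℕ K *ℕ n
    polynomial = ℕ-Solver.solve-∀

  exponent₄ : ∀ n m → D +ℕ K *ℕ (m +ℕ K *ℕ n) +ℕ E n m ≡ E (suc n) m +ℕ 0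
  exponent₄ n m = begin
    (2 *ℕ k +ℕ 2) C 2 +ℕ i +ℕ K *ℕ (m +ℕ K *ℕ n) +ℕ E n m
      ≡⟨ cong (λ c → c +ℕ i +ℕ K *ℕ (m +ℕ K *ℕ n) +ℕ E n m) (trans (cong (_C 2) (ℕ.+-suc (2 *ℕ k) 1)) ([1+n]C2 K)) ⟩
    K +ℕ K C 2 +ℕ i +ℕ K *ℕ (m +ℕ K *ℕ n) +ℕ E n m
      ≡⟨ polynomial ((K *ℕ n +ℕ 1) C 2) (K C 2) i K n m ⟩
    (K *ℕ n +ℕ 1) C 2 +ℕ K C 2 +ℕ (K *ℕ n +ℕ 1) *ℕ K +ℕ m *ℕ m +ℕ K *ℕ m *ℕ suc n +ℕ i *ℕ (m +ℕ suc n) +ℕ 0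
      ≡⟨ cong (λ c → c +ℕ m *ℕ m +ℕ K *ℕ m *ℕ suc n +ℕ i *ℕ (m +ℕ suc n) +ℕ 0) (sym ([m+n]C2 (K *ℕ n +ℕ 1) K)) ⟩
    (K *ℕ n +ℕ 1 +ℕ K) C 2 +ℕ m *ℕ m +ℕ K *ℕ m *ℕ suc n +ℕ i *ℕ (m +ℕ suc n) +ℕ 0
      ≡⟨ cong (λ t → t C 2 +ℕ m *ℕ m +ℕ K *ℕ m *ℕ suc n +ℕ i *ℕ (m +ℕ suc n) +ℕ 0) top ⟩
    E (suc n) m +ℕ 0 ∎
    where
    open ≡-Reasoning
    top : K *ℕ n +ℕ 1 +ℕ K ≡ K *ℕ suc n +ℕ 1
    top = trans (ℕ.+-comm (K *ℕ n +ℕ 1) K) (trans (sym (ℕ.+-assoc K (K *ℕ n) 1)) (cong (_+ℕ 1) (sym (ℕ.*-suc K n))))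
    polynomial : ∀ c d i K n m → K +ℕ d +ℕ i +ℕ K *ℕ (m +ℕ K *ℕ n) +ℕ (c +ℕ m *ℕ m +ℕ K *ℕ m *ℕ n +ℕ i *ℕ (m +ℕ n))
                               ≡ c +ℕ d +ℕ (K *ℕ n +ℕ 1) *ℕ K +ℕ m *ℕ m +ℕ K *ℕ m *ℕ suc n +ℕ i *ℕ (m +ℕ suc n) +ℕ 0
    polynomial = ℕ-Solver.solve-∀

  G↓ₘ G↓ₙ : ℤ → ℕ → ℕ → QS
  G↓ₘ N zero    n = qzero
  G↓ₘ N (suc m) n = shift (K *ℕ n) (G (N - + 2) n m)
  G↓ₙ N m zero    = qzero
  G↓ₙ N m (suc n) = G (N - + K) n m

  bracket : ℤ → ℕ → ℕ → QS
  bracket N m n = G N n m ⊖ shift (m +ℕ K *ℕ n) (G (N - + 1) n m) ⊖ G↓ₘ N m n ⊖ G↓ₙ N m n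

  family₂-factor : ∀ N m n → family₂ N m n ≐ scale (sgn n) (shift (E n m) (shift (m +ℕ K *ℕ n) (G (N - + 1) n m)))
  family₂-factor N m n =
    shift-scale-shift (1 *ℕ (m +ℕ K *ℕ n)) (sgn n) (E n m) (E n m) (m +ℕ K *ℕ n) (G (N - + 1) n m) (exponent₂ n m)

  family₃-factor : ∀ N m n → family₃ N m n ≐ scale (sgn n) (shift (E n m) (G↓ₘ N m n))
  family₃-factor N zero    n = ≐-sym (scale-shift-zero (sgn n) (E n 0))
  family₃-factor N (suc m) n =
    ≐-trans (shift-shift (i +ℕ 1) (2 *ℕ (m +ℕ K *ℕ n)) (term (N - + 2) m n))
            (shift-scale-shift (i +ℕ 1 +ℕ 2 *ℕ (m +ℕ K *ℕ n)) (sgn n) (E n m) (E n (suc m)) (K *ℕ n) (G (N - + 2) n m) (exponent₃ n m))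

  family₄-factor : ∀ N m n → family₄ N m n ≐ ⊝ scale (sgn n) (shift (E n m) (G↓ₙ N m n))
  family₄-factor N m zero    = ≐-sym (⊝-cong (scale-shift-zero 1ℤ (E 0 m)))
  family₄-factor N m (suc n) =
    ≐-trans (shift-shift D (K *ℕ (m +ℕ K *ℕ n)) (term (N - + K) m n))
            (≐-trans (shift-scale-shift (D +ℕ K *ℕ (m +ℕ K *ℕ n)) (sgn n) (E n m) (E (suc n) m) 0 (G (N - + K) n m) (exponent₄ n m))
                     (pointwise λ b → let x = shift (E (suc n) m) (G (N - + K) n m) b in
                        sym (trans (cong -_ (sym (ℤ.neg-distribˡ-* (sgn n) x))) (ℤ.neg-involutive (sgn n * x)))))

  family-combination : ∀ N m n →
    family₁ N m n ⊖ family₂ N m n ⊖ family₃ N m n ⊕ family₄ N m n ≐ scale (sgn n) (shift (E n m) (bracket N m n))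
  family-combination N m n =
    ≐-trans (⊕-cong (⊖-cong (⊖-cong (≐-refl {family₁ N m n}) (family₂-factor N m n)) (family₃-factor N m n))
                    (family₄-factor N m n))
            (scale-shift-distrib (sgn n) (E n m) (G N n m) (shift (m +ℕ K *ℕ n) (G (N - + 1) n m)) (G↓ₘ N m n) (G↓ₙ N m n))

  G≐gauss : ∀ N n m {A B} → topₘ N m n ≡ A → topₙ N m n ≡ B → G N n m ≐ gaussℤ 1 A m ⊛ gaussℤ K B n
  G≐gauss N n m refl refl = ⊛-cong (qbin≐gaussℤ 1 (topₘ N m n) m ℕ.≤-refl) (qbin≐gaussℤ K (topₙ N m n) n 1≤K)

  shifted-G≐ : ∀ N m n → shift (m +ℕ K *ℕ n) (G (N - + 1) n m)
                         ≐ (qmono m ⊛ qmono (K *ℕ n)) ⊛ (gaussℤ 1 (topₘ N m n - 1ℤ) m ⊛ gaussℤ K (topₙ N m n - 1ℤ) n)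
  shifted-G≐ N m n = ≐-trans (≐-sym (qmono-⊛ (m +ℕ K *ℕ n) (G (N - + 1) n m)))
    (⊛-cong (≐-sym (qmono-⊛-qmono m (K *ℕ n))) (G≐gauss (N - + 1) n m (one-less N (+ (K *ℕ n)) (+ m)) (one-less N (+ (2 *ℕ k *ℕ n)) (+ m))))
    where
    one-less : ∀ N x y → N - + 1 - x - y ≡ N - x - y - + 1
    one-less = ℤ-Solver.solve-∀

  G↓ₘ≐ : ∀ N m n → G↓ₘ N m n ≐ qmono (K *ℕ n) ⊛ (gaussℤ-pred 1 (topₘ N m n) m ⊛ gaussℤ K (topₙ N m n - 1ℤ) n)
  G↓ₘ≐ N zero    n = ≐-sym (≐-trans (⊛-cong (≐-refl {qmono (K *ℕ n)}) (⊛-zeroˡ (gaussℤ K (topₙ N 0 n - 1ℤ) n))) (⊛-zeroʳ (qmono (K *ℕ n))))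
  G↓ₘ≐ N (suc m) n = ≐-trans (≐-sym (qmono-⊛ (K *ℕ n) (G (N - + 2) n m)))
    (⊛-cong (≐-refl {qmono (K *ℕ n)}) (G≐gauss (N - + 2) n m (two-less N (+ (K *ℕ n)) (+ m) (+ 1)) (two-less N (+ (2 *ℕ k *ℕ n)) (+ m) (+ 1))))
    where
    two-less : ∀ N x y o → N - (o + o) - x - y ≡ N - x - (o + y) - o
    two-less = ℤ-Solver.solve-∀

  G↓ₙ≐ : ∀ N m n → G↓ₙ N m n ≐ gaussℤ 1 (topₘ N m n) m ⊛ gaussℤ-pred K (topₙ N m n) n
  G↓ₙ≐ N m zero    = ≐-sym (⊛-zeroʳ (gaussℤ 1 (topₘ N m 0) m))
  G↓ₙ≐ N m (suc n) = G≐gauss (N - + K) n m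
    (trans (regroup N (+ K) (+ (K *ℕ n)) (+ m)) (cong (λ t → N - + t - + m) (sym (ℕ.*-suc K n))))
    (trans (regroup′ N (+ (2 *ℕ k)) (+ (2 *ℕ k *ℕ n)) (+ m) (+ 1)) (cong (λ t → N - + t - + m - + 1) (sym (ℕ.*-suc (2 *ℕ k) n))))
    where
    regroup : ∀ N z w y → N - z - w - y ≡ N - (z + w) - y
    regroup = ℤ-Solver.solve-∀
    regroup′ : ∀ N t w y o → N - (t + o) - w - y ≡ N - (t + w) - y - o
    regroup′ = ℤ-Solver.solve-∀

  module _ (N : ℕ) (1≤N : 1 ≤ N) where

    N≢0 : N ≢ 0
    N≢0 N≡0 = contradiction (subst (1 ≤_) N≡0 1≤N) λ ()

    pascalₙ-or-vanishing-a₁ : ∀ m n →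
      gaussℤ 1 (topₘ (+ N) m n) m ≐ qzero
      ⊎ gaussℤ K (topₙ (+ N) m n) n ≐ gaussℤ-pred K (topₙ (+ N) m n) n ⊕ qmono (K *ℕ n) ⊛ gaussℤ K (topₙ (+ N) m n - 1ℤ) n
    pascalₙ-or-vanishing-a₁ m (suc n) = inj₂ (gaussℤ-pascal K (topₙ (+ N) m (suc n)) (suc n) (λ _ ()))
    pascalₙ-or-vanishing-a₁ m zero with topₙ (+ N) m 0 ℤ.≟ 0ℤ
    ... | no  B≢0 = inj₂ (gaussℤ-pascal K (topₙ (+ N) m 0) 0 (λ B≡0 → contradiction B≡0 B≢0))
    ... | yes B≡0 = inj₁ (gaussℤ-zero-top 1 m (trans A≡B B≡0) m≢0)
      where
      A≡B : topₘ (+ N) m 0 ≡ topₙ (+ N) m 0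
      A≡B = cong (λ t → + N - + t - + m) (trans (ℕ.*-zeroʳ K) (sym (ℕ.*-zeroʳ (2 *ℕ k))))
      m≢0 : m ≢ 0
      m≢0 m≡0 = N≢0 (trans (difference-zero N (2 *ℕ k *ℕ 0) m B≡0) (cong₂ _+ℕ_ (ℕ.*-zeroʳ (2 *ℕ k)) m≡0))

    pascalₘ : ∀ m n → (topₘ (+ N) m n ≡ 0ℤ → m ≢ 0) →
      gaussℤ 1 (topₘ (+ N) m n) m ≐ gaussℤ-pred 1 (topₘ (+ N) m n) m ⊕ qmono m ⊛ gaussℤ 1 (topₘ (+ N) m n - 1ℤ) m
    pascalₘ m n A≢0 = ≐-trans (gaussℤ-pascal 1 (topₘ (+ N) m n) m A≢0)
      (⊕-cong (≐-refl {gaussℤ-pred 1 (topₘ (+ N) m n) m})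
              (⊛-cong (≡⇒≐ (cong qmono (ℕ.*-identityˡ m))) (≐-refl {gaussℤ 1 (topₘ (+ N) m n - 1ℤ) m})))

    vanishing-b₀ : ∀ n → topₘ (+ N) 0 n ≡ 0ℤ → gaussℤ K (topₙ (+ N) 0 n - 1ℤ) n ≐ qzero
    vanishing-b₀ zero    A≡0 = contradiction (trans (difference-zero N (K *ℕ 0) 0 A≡0) (cong (_+ℕ 0) (ℕ.*-zeroʳ K))) N≢0
    vanishing-b₀ (suc n) A≡0 = ≐-trans (≡⇒≐ (cong (λ B → gaussℤ K B (suc n)) top)) (gauss-above K n (suc n) ℕ.≤-refl)
      where
      K-split : K *ℕ suc n ≡ 2 *ℕ k *ℕ suc n +ℕ suc n
      K-split = trans (ℕ.*-distribʳ-+ (suc n) (2 *ℕ k) 1) (cong (2 *ℕ k *ℕ suc n +ℕ_) (ℕ.*-identityˡ (suc n)))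
      N≡ : N ≡ 2 *ℕ k *ℕ suc n +ℕ suc n +ℕ 0
      N≡ = trans (difference-zero N (K *ℕ suc n) 0 A≡0) (cong (_+ℕ 0) K-split)
      cancel : ∀ x y → x + y + + 0 - x - + 0 - 1ℤ ≡ y - 1ℤ
      cancel = ℤ-Solver.solve-∀
      top : topₙ (+ N) 0 (suc n) - 1ℤ ≡ + n
      top = trans (cong (λ t → + t - + (2 *ℕ k *ℕ suc n) - + 0 - 1ℤ) N≡) (cancel (+ (2 *ℕ k *ℕ suc n)) (+ suc n))

    pascalₘ-or-vanishing-b₀ : ∀ m n →
      gaussℤ 1 (topₘ (+ N) m n) m ≐ gaussℤ-pred 1 (topₘ (+ N) m n) m ⊕ qmono m ⊛ gaussℤ 1 (topₘ (+ N) m n - 1ℤ) m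
      ⊎ gaussℤ K (topₙ (+ N) m n - 1ℤ) n ≐ qzero
    pascalₘ-or-vanishing-b₀ (suc m) n = inj₁ (pascalₘ (suc m) n (λ _ ()))
    pascalₘ-or-vanishing-b₀ zero    n with topₘ (+ N) 0 n ℤ.≟ 0ℤ
    ... | no  A≢0 = inj₁ (pascalₘ 0 n (λ A≡0 → contradiction A≡0 A≢0))
    ... | yes A≡0 = inj₂ (vanishing-b₀ n A≡0)

    bracket-vanishes : ∀ m n → bracket (+ N) m n ≐ qzero
    bracket-vanishes m n = begin
      bracket (+ N) m n
        ≈⟨ ⊖-cong (⊖-cong (⊖-cong (G≐gauss (+ N) n m refl refl) (shifted-G≐ (+ N) m n)) (G↓ₘ≐ (+ N) m n)) (G↓ₙ≐ (+ N) m n) ⟩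
      a₁ ⊛ b₁ ⊖ (u ⊛ v) ⊛ (a₀ ⊛ b₀) ⊖ v ⊛ (p ⊛ b₀) ⊖ a₁ ⊛ r
        ≈⟨ pascal-product a₁ a₀ p b₁ b₀ r u v (pascalₙ-or-vanishing-a₁ m n) (pascalₘ-or-vanishing-b₀ m n) ⟩
      qzero ∎
      where
      open ≐-Reasoning
      a₁ = gaussℤ 1 (topₘ (+ N) m n) m
      a₀ = gaussℤ 1 (topₘ (+ N) m n - 1ℤ) m
      p  = gaussℤ-pred 1 (topₘ (+ N) m n) m
      b₁ = gaussℤ K (topₙ (+ N) m n) n
      b₀ = gaussℤ K (topₙ (+ N) m n - 1ℤ) n
      r  = gaussℤ-pred K (topₙ (+ N) m n) n
      u  = qmono m
      v  = qmono (K *ℕ n)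

    family-combination-vanishes : ∀ m n →
      family₁ (+ N) m n ⊖ family₂ (+ N) m n ⊖ family₃ (+ N) m n ⊕ family₄ (+ N) m n ≐ qzero
    family-combination-vanishes m n =
      ≐-trans (family-combination (+ N) m n)
              (≐-trans (scale-cong (sgn n) (shift-cong (E n m) (bracket-vanishes m n))) (scale-shift-zero (sgn n) (E n m)))

theorem2p4 : (i k : ℕ) (N : ℤ) → + 1 ≤ℤ N → (a b : ℕ) → LHS i k N a b ≡ 0ℤ
theorem2p4 i k (+ N) (+≤+ 1≤N) a = coeff (begin
  LHS i k (+ N) a
    ≈⟨ LHS-blocks (+ N) a ⟩
  blocks K (family₁ (+ N)) a ⊖ blocks K (family₂ (+ N)) a ⊖ blocks K (family₃ (+ N)) a ⊕ blocks K (family₄ (+ N)) a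
    ≈⟨ blocks-combination K (family₁ (+ N)) (family₂ (+ N)) (family₃ (+ N)) (family₄ (+ N)) a ⟩
  blocks K (λ m n → family₁ (+ N) m n ⊖ family₂ (+ N) m n ⊖ family₃ (+ N) m n ⊕ family₄ (+ N) m n) a
    ≈⟨ blocks-zero K _ a (family-combination-vanishes N 1≤N) ⟩
  qzero ∎)
  where
  open Recurrence i k
  open ≐-Reasoning
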